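{- Let $n = 2^k-1$, let $C \subseteq F^n$ be a binary perfect code containing $0^n$, and let $\lambda : C \to \{0,1\}$ satisfy $\lambda(0^n) = 0$. Let $V_C^\lambda = \{(x+y,\ |x| + \lambda(y),\ x) : x \in F^n, y \in C\} \subseteq F^{2n+1}$ be the Vasil'ev code. Let $y' \in C$ and $z = (y', \lambda(y'), 0^n) \in V_C^\lambda$. Then a permutation $\rho \in S_{2n+1}$ belongs to $\mathrm{St}_{n+1}(\mathrm{Rot}_z(V_C^\lambda))$ (i.e. $z + \rho(V_C^\lambda) = V_C^\lambda$ and $\rho(n+1) = n+1$) if and only if $\rho = \sigma_{\pi} \circ \tau_u$ for some $\pi \in \mathrm{Rot}_{y'}(C)$ and $u \in F^n$ such that for every $y \in C$ $$\lambda(y') + \lambda(y) + \lambda(y' + \pi(y)) = u \cdot y,$$ where $u\cdot y$ is the standard inner product over $\mathbb{F}_2$.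
   Context: For $x\in F^n$, $|x| = x_1+\dots+x_n \pmod 2$. Permutations $\pi\in S_n$ act on $F^n$ by permuting coordinates. For a code $C\subseteq F^n$ and $y \in C$, $\mathrm{Rot}_y(C) = \{\pi \in S_n : y + \pi(C) = C\}$. For $i\in\{1,\dots,n\}$, $t_i\in S_{2n+1}$ is the transposition of $i$ and $i+n+1$; for $u \in F^n$, $\tau_u = \prod_{i \in \mathrm{supp}(u)} t_i$. For $\pi \in S_n$, the "duplicator" $\sigma_\pi \in S_{2n+1}$ is defined by $\sigma_\pi(i) = \pi(i)$ and $\sigma_\pi(i+n+1) = \pi(i)+n+1$ for $1\le i\le n$, and $\sigma_\pi(n+1) = n+1$. In $\sigma_\pi\circ\tau_u$, $\tau_u$ is applied first. -}

module Defs where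

open import Data.Nat using (ℕ; zero; suc; _+_; _≤_)
open import Data.Bool using (Bool; true; false; _xor_; _∧_; if_then_else_)
open import Data.Vec using (Vec; []; _∷_; zipWith; foldr; tabulate; lookup; replicate; _++_)
open import Data.Fin using (Fin; zero; suc; splitAt; _↑ˡ_; _↑ʳ_)
open import Data.Fin.Permutation using (Permutation′; _⟨$⟩ʳ_; _⟨$⟩ˡ_)
open import Data.Sum using (inj₁; inj₂)
open import Data.Product using (_×_; ∃)
open import Relation.Binary.PropositionalEquality using (_≡_)

-- binary words of length n (F = Bool, xor = addition in F_2)
Word : ℕ → Set
Word n = Vec Bool n

Code : ℕ → Set₁
Code n = Word n → Set

_⊕_ : ∀ {n} → Word n → Word n → Word n
_⊕_ = zipWith _xor_

zeroW : ∀ n → Word n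
zeroW n = replicate n false

-- |x| = x_1 + ... + x_n mod 2
parity : ∀ {n} → Word n → Bool
parity = foldr _ _xor_ false

_·_ : ∀ {n} → Word n → Word n → Bool
u · y = parity (zipWith _∧_ u y)

weight : ∀ {n} → Word n → ℕ
weight [] = 0
weight (true ∷ x) = suc (weight x)
weight (false ∷ x) = weight x

dist : ∀ {n} → Word n → Word n → ℕ
dist x y = weight (x ⊕ y)

Perfect : ∀ {n} → Code n → Set
Perfect {n} C = ∀ (x : Word n) → ∃ λ c → C c × dist x c ≤ 1
                  × (∀ c' → C c' → dist x c' ≤ 1 → c' ≡ c)

-- action of a permutation on coordinates: coordinate i of x is moved to
-- position π(i), i.e. π(x)_j = x_{π⁻¹(j)}
act : ∀ {n} → Permutation′ n → Word n → Word n
act π x = tabulate (λ j → lookup x (π ⟨$⟩ˡ j))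

TransEq : ∀ {n} → Word n → Permutation′ n → Code n → Code n → Set
TransEq y π C D = (∀ v → C v → D (y ⊕ act π v))
                × (∀ w → D w → ∃ λ v → C v × w ≡ y ⊕ act π v)

InRot : ∀ {n} → Code n → Word n → Permutation′ n → Set
InRot C y π = TransEq y π C C

-- Vasil'ev code V_C^λ ⊆ F^{2n+1}; words of length 2n+1 are indexed by
-- Fin (n + suc n): first block i ↑ˡ suc n (positions 1..n),
-- middle coordinate n ↑ʳ zero (position n+1),
-- last block n ↑ʳ suc i (positions n+2..2n+1).
vasWord : ∀ {n} → (Word n → Bool) → Word n → Word n → Word (n + suc n)
vasWord λf x y = (x ⊕ y) ++ ((parity x xor λf y) ∷ x)

Vasilev : ∀ {n} → Code n → (Word n → Bool) → Code (n + suc n)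
Vasilev {n} C λf w = ∃ λ (x : Word n) → ∃ λ (y : Word n) → C y × w ≡ vasWord λf x y

mid : ∀ n → Fin (n + suc n)
mid n = n ↑ʳ zero

-- τ_u : product of transpositions (i, i+n+1) for i ∈ supp(u)
tau : ∀ {n} → Word n → Fin (n + suc n) → Fin (n + suc n)
tau {n} u j with splitAt n j
... | inj₁ i = if lookup u i then n ↑ʳ suc i else i ↑ˡ suc n
... | inj₂ zero = n ↑ʳ zero
... | inj₂ (suc i) = if lookup u i then i ↑ˡ suc n else n ↑ʳ suc i

sigma : ∀ {n} → Permutation′ n → Fin (n + suc n) → Fin (n + suc n)
sigma {n} π j with splitAt n j
... | inj₁ i = (π ⟨$⟩ʳ i) ↑ˡ suc n
... | inj₂ zero = n ↑ʳ zero
... | inj₂ (suc i) = n ↑ʳ suc (π ⟨$⟩ʳ i)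

module Submission where

-- Write F^(2n+1) as n columns {i, i+n+1} together with the middle coordinate
-- n+1, and fold a word (A, m, B) to A + B ∈ F^n.  The proof has two halves.
--
-- Translation (no perfectness needed).  If ρ = σ_π ∘ τ_u, an explicit
-- computation gives z + ρ(x + y, |x| + λ(y), x) = (X + y' + π(y), m', X) with
-- X = π(x + u ∧ y).  Reading Vasil'ev membership off the blocks, this word is
-- in V_C^λ iff y' + π(y) ∈ C and λ(y') + λ(y) + λ(y' + π(y)) = u · y.  Hence
-- ρ ∈ Rot_z(V_C^λ) iff π ∈ Rot_{y'}(C) and the condition on λ holds.
--
-- Structure (uses perfectness).  If ρ ∈ Rot_z(V_C^λ) fixes the middle
-- coordinate, the image of the Vasil'ev word (e_i, 1, e_i) shows that
-- y' + e_a + e_b ∈ C where a, b are the columns hit by the two ends of column i.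
-- A perfect code has no two codewords at distance 2, so a = b: ρ maps columns
-- to columns, and such a permutation is σ_π ∘ τ_u.

open import Defs
open import Data.Nat using (ℕ; suc; zero; _+_; _^_; _∸_; _≤_; z≤n; s≤s)
open import Data.Bool using (Bool; true; false; _xor_; _∧_; if_then_else_)
open import Data.Bool.Properties
  using (xor-assoc; xor-comm; xor-identityˡ; xor-identityʳ; xor-same; ¬-not; xor-∧-commutativeRing)
open import Data.Bool.Solver using (module xor-∧-Solver)
open import Data.Fin using (Fin; zero; suc; splitAt; _↑ˡ_; _↑ʳ_)
open import Data.Fin.Properties using (_≟_; splitAt-↑ˡ; splitAt-↑ʳ; splitAt⁻¹-↑ˡ; splitAt⁻¹-↑ʳ)
open import Data.Fin.Permutation using (Permutation′; _⟨$⟩ʳ_; _⟨$⟩ˡ_; inverseˡ; inverseʳ; flip; permutation)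
open import Data.Vec using ([]; _∷_; zipWith; tabulate; lookup; _++_)
open import Data.Vec.Properties
  using (lookup∘tabulate; tabulate∘lookup; lookup-++ˡ; lookup-++ʳ; tabulate-cong; lookup-zipWith; lookup-replicate;
         zipWith-assoc; zipWith-comm; zipWith-identityˡ; zipWith-identityʳ; zipWith-++;
         ++-injective; ∷-injective)
open import Data.Maybe using (Maybe; just; nothing)
open import Data.Sum using (inj₁; inj₂)
open import Data.Product using (_×_; ∃; _,_; proj₁; proj₂)
open import Data.Empty using (⊥-elim)
open import Function.Bundles using (_⇔_; mk⇔; module Equivalence)
open import Relation.Binary.PropositionalEquality
open import Relation.Nullary using (Dec; yes; no)
open import Algebra.Bundles using (CommutativeRing)
import Algebra.Properties.CommutativeMonoid.Sum as MonoidSum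

-- Arithmetic in F_2 = (Bool, xor, ∧).

-- Identities of F_2 are decided by the ring solver: its coefficients are
-- computed in Bool itself, so it knows that x + x = 0.
open xor-∧-Solver using (solve; _:+_; _:=_)

xor-interchange : ∀ a b c d → (a xor b) xor (c xor d) ≡ (a xor c) xor (b xor d)
xor-interchange = solve 4 (λ a b c d → (a :+ b) :+ (c :+ d) := (a :+ c) :+ (b :+ d)) refl

xor-zero⇒≡ : ∀ {a b} → a xor b ≡ false → a ≡ b
xor-zero⇒≡ {false} {false} _ = refl
xor-zero⇒≡ {true}  {true}  _ = refl
xor-zero⇒≡ {false} {true}  ()
xor-zero⇒≡ {true}  {false} ()

≡⇒xor-zero : ∀ {a b} → a ≡ b → a xor b ≡ false
≡⇒xor-zero {a} refl = xor-same a

-- The bit identity behind the middle coordinate of a translated Vasil'ev word: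
-- a + (p + b) = (p + d) + c  iff  a + b + c = d.
middle-condition : ∀ a b c d p → (a xor (p xor b) ≡ (p xor d) xor c) ⇔ ((a xor b) xor c ≡ d)
middle-condition a b c d p =
  mk⇔ (λ e → xor-zero⇒≡ (trans (sym difference) (≡⇒xor-zero e)))
      (λ e → xor-zero⇒≡ (trans difference (≡⇒xor-zero e)))
  where
  difference : (a xor (p xor b)) xor ((p xor d) xor c) ≡ ((a xor b) xor c) xor d
  difference = solve 5 (λ a b c d p → (a :+ (p :+ b)) :+ ((p :+ d) :+ c)
                                      := ((a :+ b) :+ c) :+ d) refl a b c d p

⊕-assoc : ∀ {n} (x y w : Word n) → (x ⊕ y) ⊕ w ≡ x ⊕ (y ⊕ w)
⊕-assoc = zipWith-assoc xor-assoc

⊕-comm : ∀ {n} (x y : Word n) → x ⊕ y ≡ y ⊕ x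
⊕-comm = zipWith-comm xor-comm

⊕-identityˡ : ∀ {n} (x : Word n) → zeroW n ⊕ x ≡ x
⊕-identityˡ = zipWith-identityˡ xor-identityˡ

⊕-identityʳ : ∀ {n} (x : Word n) → x ⊕ zeroW n ≡ x
⊕-identityʳ = zipWith-identityʳ xor-identityʳ

⊕-self : ∀ {n} (x : Word n) → x ⊕ x ≡ zeroW n
⊕-self []      = refl
⊕-self (a ∷ x) = cong₂ _∷_ (xor-same a) (⊕-self x)

⊕-cancelˡ : ∀ {n} (x y : Word n) → x ⊕ (x ⊕ y) ≡ y
⊕-cancelˡ x y = begin
  x ⊕ (x ⊕ y)  ≡⟨ ⊕-assoc x x y ⟨
  (x ⊕ x) ⊕ y  ≡⟨ cong (_⊕ y) (⊕-self x) ⟩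
  zeroW _ ⊕ y  ≡⟨ ⊕-identityˡ y ⟩
  y            ∎
  where open ≡-Reasoning

⊕-cancelʳ : ∀ {n} (x y : Word n) → (x ⊕ y) ⊕ x ≡ y
⊕-cancelʳ x y = trans (⊕-comm (x ⊕ y) x) (⊕-cancelˡ x y)

⊕-injectiveʳ : ∀ {n} (x y w : Word n) → x ⊕ y ≡ x ⊕ w → y ≡ w
⊕-injectiveʳ x y w e = trans (sym (⊕-cancelˡ x y)) (trans (cong (x ⊕_) e) (⊕-cancelˡ x w))

⊕-interchange : ∀ {n} (a b c d : Word n) → (a ⊕ b) ⊕ (c ⊕ d) ≡ (a ⊕ c) ⊕ (b ⊕ d)
⊕-interchange []      []      []      []      = refl
⊕-interchange (a ∷ x) (b ∷ y) (c ∷ z) (d ∷ w) =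
  cong₂ _∷_ (xor-interchange a b c d) (⊕-interchange x y z w)

⊕-cancel-common : ∀ {n} (c x y : Word n) → (c ⊕ x) ⊕ (c ⊕ y) ≡ x ⊕ y
⊕-cancel-common c x y = begin
  (c ⊕ x) ⊕ (c ⊕ y)  ≡⟨ ⊕-interchange c x c y ⟩
  (c ⊕ c) ⊕ (x ⊕ y)  ≡⟨ cong (_⊕ (x ⊕ y)) (⊕-self c) ⟩
  zeroW _ ⊕ (x ⊕ y)  ≡⟨ ⊕-identityˡ (x ⊕ y) ⟩
  x ⊕ y              ∎
  where open ≡-Reasoning

lookup-⊕ : ∀ {n} (x y : Word n) i → lookup (x ⊕ y) i ≡ lookup x i xor lookup y i
lookup-⊕ x y i = lookup-zipWith _xor_ i x y

lookup-ext : ∀ {n} {x y : Word n} → (∀ i → lookup x i ≡ lookup y i) → x ≡ y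
lookup-ext {x = x} {y} h =
  trans (sym (tabulate∘lookup x)) (trans (tabulate-cong h) (tabulate∘lookup y))

++-⊕ : ∀ {m n} (a c : Word m) (b d : Word n) → (a ++ b) ⊕ (c ++ d) ≡ (a ⊕ c) ++ (b ⊕ d)
++-⊕ a c b d = zipWith-++ _xor_ a b c d

blocks-injective : ∀ {n} {A A' B B' : Word n} {m m' : Bool}
  → A ++ (m ∷ B) ≡ A' ++ (m' ∷ B') → A ≡ A' × m ≡ m' × B ≡ B'
blocks-injective {A = A} {A'} e with ++-injective A A' e
... | eA , eRest with ∷-injective eRest
... | em , eB = eA , em , eB

parity-⊕ : ∀ {n} (x y : Word n) → parity (x ⊕ y) ≡ parity x xor parity y
parity-⊕ []      []      = refl
parity-⊕ (a ∷ x) (b ∷ y) =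
  trans (cong ((a xor b) xor_) (parity-⊕ x y)) (xor-interchange a b (parity x) (parity y))

parity-zeroW : ∀ n → parity (zeroW n) ≡ false
parity-zeroW zero    = refl
parity-zeroW (suc n) = parity-zeroW n

unit : ∀ {n} → Fin n → Word n
unit {suc n} zero    = true ∷ zeroW n
unit         (suc i) = false ∷ unit i

unit-same : ∀ {n} (a : Fin n) → lookup (unit a) a ≡ true
unit-same zero    = refl
unit-same (suc a) = unit-same a

unit-diff : ∀ {n} (a c : Fin n) → a ≢ c → lookup (unit a) c ≡ false
unit-diff         zero    zero    a≢c = ⊥-elim (a≢c refl)
unit-diff {suc n} zero    (suc c) _   = lookup-replicate c false
unit-diff         (suc a) zero    _   = refl
unit-diff         (suc a) (suc c) a≢c = unit-diff a c (λ e → a≢c (cong suc e))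

unit-injective : ∀ {n} {a b : Fin n} → unit a ≡ unit b → a ≡ b
unit-injective {a = a} {b} e with b ≟ a
... | yes b≡a = sym b≡a
... | no  b≢a with trans (sym (unit-diff b a b≢a)) (trans (cong (λ w → lookup w a) (sym e)) (unit-same a))
...   | ()

weight-unit : ∀ {n} (a : Fin n) → weight (unit a) ≡ 1
weight-unit {suc n} zero    = cong suc (weight-zeroW n)
  where
  weight-zeroW : ∀ n → weight (zeroW n) ≡ 0
  weight-zeroW zero    = refl
  weight-zeroW (suc n) = weight-zeroW n
weight-unit         (suc a) = weight-unit a

parity-unit : ∀ {n} (a : Fin n) → parity (unit a) ≡ true
parity-unit {suc n} zero    = cong (true xor_) (parity-zeroW n)
parity-unit         (suc a) = parity-unit a

unit-↑ˡ : ∀ {n} m (i : Fin n) → unit (i ↑ˡ m) ≡ unit i ++ zeroW m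
unit-↑ˡ {suc n} m zero    = cong (true ∷_) (zeroW-++ n)
  where
  zeroW-++ : ∀ n → zeroW (n + m) ≡ zeroW n ++ zeroW m
  zeroW-++ zero    = refl
  zeroW-++ (suc n) = cong (false ∷_) (zeroW-++ n)
unit-↑ˡ         m (suc i) = cong (false ∷_) (unit-↑ˡ m i)

unit-↑ʳ : ∀ {m} n (j : Fin m) → unit (n ↑ʳ j) ≡ zeroW n ++ unit j
unit-↑ʳ zero    j = refl
unit-↑ʳ (suc n) j = cong (false ∷_) (unit-↑ʳ n j)

-- Perfect codes.

-- A perfect code has minimum distance 3: if c and c + e_a + e_b are both
-- codewords then a = b, since both lie within distance 1 of c + e_a and the
-- codeword nearest to c + e_a is unique.
perfect-no-distance-two : ∀ {n} {C : Code n} → Perfect C → ∀ {c} {a b : Fin n}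
  → C c → C (c ⊕ (unit a ⊕ unit b)) → a ≡ b
perfect-no-distance-two {n} {C} perfect {c} {a} {b} Cc Cc' with perfect (c ⊕ unit a)
... | nearest , _ , _ , unique = unit-injective ea≡eb
  where
  ea eb : Word n
  ea = unit a
  eb = unit b
  within-1 : ∀ {v} (i : Fin n) → (c ⊕ ea) ⊕ v ≡ unit i → dist (c ⊕ ea) v ≤ 1
  within-1 i e rewrite e | weight-unit i = s≤s z≤n
  c≡nearest : c ≡ nearest
  c≡nearest = unique c Cc (within-1 a (begin
    (c ⊕ ea) ⊕ c              ≡⟨ cong ((c ⊕ ea) ⊕_) (⊕-identityʳ c) ⟨
    (c ⊕ ea) ⊕ (c ⊕ zeroW n)  ≡⟨ ⊕-cancel-common c ea (zeroW n) ⟩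
    ea ⊕ zeroW n              ≡⟨ ⊕-identityʳ ea ⟩
    ea                        ∎))
    where open ≡-Reasoning
  c'≡nearest : c ⊕ (ea ⊕ eb) ≡ nearest
  c'≡nearest = unique _ Cc' (within-1 b (trans (⊕-cancel-common c ea (ea ⊕ eb)) (⊕-cancelˡ ea eb)))
  ea≡eb : ea ≡ eb
  ea≡eb = begin
    ea                         ≡⟨ ⊕-identityʳ ea ⟨
    ea ⊕ zeroW n               ≡⟨ cong (ea ⊕_) (⊕-injectiveʳ c _ _ (trans (⊕-identityʳ c) (trans c≡nearest (sym c'≡nearest)))) ⟩
    ea ⊕ (ea ⊕ eb)             ≡⟨ ⊕-cancelˡ ea eb ⟩
    eb                         ∎
    where open ≡-Reasoning

⟨$⟩ʳ-injective : ∀ {n} (π : Permutation′ n) {i j} → π ⟨$⟩ʳ i ≡ π ⟨$⟩ʳ j → i ≡ j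
⟨$⟩ʳ-injective π e = trans (sym (inverseˡ π)) (trans (cong (π ⟨$⟩ˡ_) e) (inverseˡ π))

lookup-act : ∀ {n} (π : Permutation′ n) x i → lookup (act π x) (π ⟨$⟩ʳ i) ≡ lookup x i
lookup-act π x i = trans (lookup∘tabulate _ (π ⟨$⟩ʳ i)) (cong (lookup x) (inverseˡ π))

act-char : ∀ {n} (π : Permutation′ n) (x y : Word n)
  → (∀ i → lookup y (π ⟨$⟩ʳ i) ≡ lookup x i) → act π x ≡ y
act-char π x y h = lookup-ext agree
  where
  open ≡-Reasoning
  agree : ∀ j → lookup (act π x) j ≡ lookup y j
  agree j = begin
    lookup (act π x) j                      ≡⟨ cong (lookup (act π x)) (inverseʳ π) ⟨
    lookup (act π x) (π ⟨$⟩ʳ (π ⟨$⟩ˡ j))    ≡⟨ lookup-act π x _ ⟩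
    lookup x (π ⟨$⟩ˡ j)                     ≡⟨ h _ ⟨
    lookup y (π ⟨$⟩ʳ (π ⟨$⟩ˡ j))            ≡⟨ cong (lookup y) (inverseʳ π) ⟩
    lookup y j                              ∎

act-⊕ : ∀ {n} (π : Permutation′ n) x y → act π (x ⊕ y) ≡ act π x ⊕ act π y
act-⊕ π x y = act-char π (x ⊕ y) _ λ i → begin
  lookup (act π x ⊕ act π y) (π ⟨$⟩ʳ i)                      ≡⟨ lookup-⊕ (act π x) (act π y) _ ⟩
  lookup (act π x) (π ⟨$⟩ʳ i) xor lookup (act π y) (π ⟨$⟩ʳ i) ≡⟨ cong₂ _xor_ (lookup-act π x i) (lookup-act π y i) ⟩
  lookup x i xor lookup y i                                  ≡⟨ lookup-⊕ x y i ⟨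
  lookup (x ⊕ y) i                                           ∎
  where open ≡-Reasoning

act-unit : ∀ {n} (π : Permutation′ n) i → act π (unit i) ≡ unit (π ⟨$⟩ʳ i)
act-unit π i = act-char π (unit i) _ λ k → same-entry k (i ≟ k)
  where
  same-entry : ∀ k → Dec (i ≡ k) → lookup (unit (π ⟨$⟩ʳ i)) (π ⟨$⟩ʳ k) ≡ lookup (unit i) k
  same-entry k (yes refl) = trans (unit-same (π ⟨$⟩ʳ i)) (sym (unit-same i))
  same-entry k (no i≢k)   =
    trans (unit-diff _ _ (λ e → i≢k (⟨$⟩ʳ-injective π e))) (sym (unit-diff i k i≢k))

act-flip : ∀ {n} (π : Permutation′ n) x → act π (act (flip π) x) ≡ x
act-flip π x = act-char π (act (flip π) x) x λ i → sym (lookup∘tabulate (λ j → lookup x (flip π ⟨$⟩ˡ j)) i)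

parity-act : ∀ {n} (π : Permutation′ n) x → parity (act π x) ≡ parity x
parity-act π x = trans (parity-sum (act π x))
  (trans (Sum.sum-permute _ π)
  (trans (Sum.sum-cong-≗ (lookup-act π x)) (sym (parity-sum x))))
  where
  module Sum = MonoidSum (CommutativeRing.+-commutativeMonoid xor-∧-commutativeRing)
  parity-sum : ∀ {n} (x : Word n) → parity x ≡ Sum.sum (lookup x)
  parity-sum []      = refl
  parity-sum (a ∷ x) = cong (a xor_) (parity-sum x)

-- Coordinate i of the first block is pos i false,
-- coordinate i+n+1 of the last block is pos i true; together they form the
-- column i.  The remaining coordinate is the middle one, mid n.

pos : ∀ {n} → Fin n → Bool → Fin (n + suc n)
pos {n} i false = i ↑ˡ suc n
pos {n} i true  = n ↑ʳ suc i

decode : ∀ {n} → Fin (n + suc n) → Maybe (Fin n × Bool)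
decode {n} j with splitAt n j
... | inj₁ i       = just (i , false)
... | inj₂ zero    = nothing
... | inj₂ (suc i) = just (i , true)

decode-pos : ∀ {n} (i : Fin n) b → decode (pos i b) ≡ just (i , b)
decode-pos {n} i false rewrite splitAt-↑ˡ n i (suc n)       = refl
decode-pos {n} i true  rewrite splitAt-↑ʳ n (suc n) (suc i) = refl

decode-mid : ∀ n → decode (mid n) ≡ nothing
decode-mid n rewrite splitAt-↑ʳ n (suc n) zero = refl

pos-injective : ∀ {n} {i i' : Fin n} {b b'} → pos i b ≡ pos i' b' → i ≡ i' × b ≡ b'
pos-injective {i = i} {i'} {b} {b'} e
  with trans (sym (decode-pos i b)) (trans (cong decode e) (decode-pos i' b'))
... | refl = refl , refl

pos≢mid : ∀ {n} (i : Fin n) b → pos i b ≢ mid n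
pos≢mid {n} i b e with trans (sym (decode-pos i b)) (trans (cong decode e) (decode-mid n))
... | ()

data Position (n : ℕ) : Fin (n + suc n) → Set where
  centre : Position n (mid n)
  at     : (i : Fin n) (b : Bool) → Position n (pos i b)

position : ∀ {n} (j : Fin (n + suc n)) → Position n j
position {n} j with splitAt n j in eq
... | inj₁ i       = subst (Position n) (splitAt⁻¹-↑ˡ eq) (at i false)
... | inj₂ zero    = subst (Position n) (splitAt⁻¹-↑ʳ eq) centre
... | inj₂ (suc i) = subst (Position n) (splitAt⁻¹-↑ʳ eq) (at i true)

lookup-pos : ∀ {n} (A B : Word n) m i b
  → lookup (A ++ (m ∷ B)) (pos i b) ≡ (if b then lookup B i else lookup A i)
lookup-pos A B m i false = lookup-++ˡ A (m ∷ B) i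
lookup-pos A B m i true  = lookup-++ʳ A (m ∷ B) (suc i)

lookup-mid : ∀ {n} (A B : Word n) m → lookup (A ++ (m ∷ B)) (mid n) ≡ m
lookup-mid A B m = lookup-++ʳ A (m ∷ B) zero

tau-pos : ∀ {n} (u : Word n) i b → tau u (pos i b) ≡ pos i (b xor lookup u i)
tau-pos {n} u i false rewrite splitAt-↑ˡ n i (suc n) with lookup u i
... | false = refl
... | true  = refl
tau-pos {n} u i true rewrite splitAt-↑ʳ n (suc n) (suc i) with lookup u i
... | false = refl
... | true  = refl

tau-mid : ∀ {n} (u : Word n) → tau u (mid n) ≡ mid n
tau-mid {n} u rewrite splitAt-↑ʳ n (suc n) zero = refl

sigma-pos : ∀ {n} (π : Permutation′ n) i b → sigma π (pos i b) ≡ pos (π ⟨$⟩ʳ i) b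
sigma-pos {n} π i false rewrite splitAt-↑ˡ n i (suc n)       = refl
sigma-pos {n} π i true  rewrite splitAt-↑ʳ n (suc n) (suc i) = refl

sigma-mid : ∀ {n} (π : Permutation′ n) → sigma π (mid n) ≡ mid n
sigma-mid {n} π rewrite splitAt-↑ʳ n (suc n) zero = refl

sigma-tau-pos : ∀ {n} (π : Permutation′ n) u i b
  → sigma π (tau u (pos i b)) ≡ pos (π ⟨$⟩ʳ i) (b xor lookup u i)
sigma-tau-pos π u i b = trans (cong (sigma π) (tau-pos u i b)) (sigma-pos π i (b xor lookup u i))

sigma-tau-mid : ∀ {n} (π : Permutation′ n) u → sigma π (tau u (mid n)) ≡ mid n
sigma-tau-mid π u = trans (cong (sigma π) (tau-mid u)) (sigma-mid π)

fold : ∀ {n} → Word (n + suc n) → Word n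
fold w = tabulate λ i → lookup w (pos i false) xor lookup w (pos i true)

lookup-fold : ∀ {n} (w : Word (n + suc n)) i
  → lookup (fold w) i ≡ lookup w (pos i false) xor lookup w (pos i true)
lookup-fold w i = lookup∘tabulate _ i

fold-blocks : ∀ {n} (A B : Word n) m → fold (A ++ (m ∷ B)) ≡ A ⊕ B
fold-blocks A B m = lookup-ext λ i →
  trans (lookup-fold (A ++ (m ∷ B)) i)
  (trans (cong₂ _xor_ (lookup-pos A B m i false) (lookup-pos A B m i true)) (sym (lookup-⊕ A B i)))

fold-⊕ : ∀ {n} (v w : Word (n + suc n)) → fold (v ⊕ w) ≡ fold v ⊕ fold w
fold-⊕ v w = lookup-ext λ i → begin
  lookup (fold (v ⊕ w)) i
    ≡⟨ lookup-fold (v ⊕ w) i ⟩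
  lookup (v ⊕ w) (pos i false) xor lookup (v ⊕ w) (pos i true)
    ≡⟨ cong₂ _xor_ (lookup-⊕ v w (pos i false)) (lookup-⊕ v w (pos i true)) ⟩
  (lookup v (pos i false) xor lookup w (pos i false)) xor (lookup v (pos i true) xor lookup w (pos i true))
    ≡⟨ xor-interchange (lookup v (pos i false)) (lookup w (pos i false)) (lookup v (pos i true)) (lookup w (pos i true)) ⟩
  (lookup v (pos i false) xor lookup v (pos i true)) xor (lookup w (pos i false) xor lookup w (pos i true))
    ≡⟨ cong₂ _xor_ (lookup-fold v i) (lookup-fold w i) ⟨
  lookup (fold v) i xor lookup (fold w) i
    ≡⟨ lookup-⊕ (fold v) (fold w) i ⟨
  lookup (fold v ⊕ fold w) i
    ∎
  where open ≡-Reasoning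

fold-unit-pos : ∀ {n} (i : Fin n) b → fold (unit (pos i b)) ≡ unit i
fold-unit-pos {n} i false = trans (cong fold (unit-↑ˡ (suc n) i))
  (trans (fold-blocks (unit i) (zeroW n) false) (⊕-identityʳ (unit i)))
fold-unit-pos {n} i true  = trans (cong fold (unit-↑ʳ n (suc i)))
  (trans (fold-blocks (zeroW n) (unit i) false) (⊕-identityˡ (unit i)))

fold-unit-mid : ∀ n → fold (unit (mid n)) ≡ zeroW n
fold-unit-mid n = trans (cong fold (unit-↑ʳ n zero))
  (trans (fold-blocks (zeroW n) (zeroW n) true) (⊕-self (zeroW n)))

-- The Vasil'ev code.

-- Membership in V_C^λ read off the blocks: (A, m, B) ∈ V_C^λ iff A + B ∈ C
-- and m = |B| + λ(A + B)  (take x = B and y = A + B).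
vasilev-blocks : ∀ {n} {C : Code n} {lam : Word n → Bool} (A B : Word n) m
  → Vasilev C lam (A ++ (m ∷ B)) ⇔ (C (A ⊕ B) × m ≡ parity B xor lam (A ⊕ B))
vasilev-blocks {n} {C} {lam} A B m = mk⇔ to from
  where
  to : Vasilev C lam (A ++ (m ∷ B)) → C (A ⊕ B) × m ≡ parity B xor lam (A ⊕ B)
  to (x , y , Cy , e) with blocks-injective e
  ... | refl , em , refl = subst C (sym (⊕-cancelʳ x y)) Cy
                         , trans em (cong (λ w → parity x xor lam w) (sym (⊕-cancelʳ x y)))
  from : C (A ⊕ B) × m ≡ parity B xor lam (A ⊕ B) → Vasilev C lam (A ++ (m ∷ B))
  from (CAB , em) = B , A ⊕ B , CAB , cong₂ (λ a c → a ++ (c ∷ B)) (sym B⊕[A⊕B]≡A) em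
    where
    B⊕[A⊕B]≡A : B ⊕ (A ⊕ B) ≡ A
    B⊕[A⊕B]≡A = trans (cong (B ⊕_) (⊕-comm A B)) (⊕-cancelˡ B A)

vasilev-middle-unique : ∀ {n} {C : Code n} {lam : Word n → Bool} {A B : Word n} {m m'}
  → Vasilev C lam (A ++ (m ∷ B)) → Vasilev C lam (A ++ (m' ∷ B)) → m ≡ m'
vasilev-middle-unique {A = A} {B} {m} {m'} v v' =
  trans (proj₂ (Equivalence.to (vasilev-blocks A B m) v))
        (sym (proj₂ (Equivalence.to (vasilev-blocks A B m') v')))

fold-vasWord : ∀ {n} (lam : Word n → Bool) x y → fold (vasWord lam x y) ≡ y
fold-vasWord lam x y = trans (fold-blocks (x ⊕ y) x _) (⊕-cancelʳ x y)

vasilev-fold : ∀ {n} {C : Code n} {lam : Word n → Bool} {w} → Vasilev C lam w → C (fold w)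
vasilev-fold {C = C} {lam} (x , y , Cy , refl) = subst C (sym (fold-vasWord lam x y)) Cy

-- How σ_π ∘ τ_u acts on a word (x + y, m, x): column i, holding
-- (x_i + y_i, x_i), is swapped when u_i = 1 and moved to column π(i).
-- Both blocks change by π(u ∧ y), giving (X + π(y), m, X) with X = π(x + u ∧ y).

_∧w_ : ∀ {n} → Word n → Word n → Word n
_∧w_ = zipWith _∧_

column-swap : ∀ b u x y
  → (if b xor u then x xor (u ∧ y) else (x xor (u ∧ y)) xor y) ≡ (if b then x else x xor y)
column-swap false false x y = cong (_xor y) (xor-identityʳ x)
column-swap false true  x y = refl
column-swap true  false x y = xor-identityʳ x
column-swap true  true  x y = solve 2 (λ x y → (x :+ y) :+ y := x) refl x y

duplicator-action : ∀ {n} (ρ : Permutation′ (n + suc n)) (π : Permutation′ n) (u : Word n)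
  → (∀ j → ρ ⟨$⟩ʳ j ≡ sigma π (tau u j))
  → ∀ x y m → act ρ ((x ⊕ y) ++ (m ∷ x))
              ≡ (act π (x ⊕ (u ∧w y)) ⊕ act π y) ++ (m ∷ act π (x ⊕ (u ∧w y)))
duplicator-action {n} ρ π u ρ-form x y m = act-char ρ w w' λ j → agree (position j)
  where
  open ≡-Reasoning
  X : Word n
  X = act π (x ⊕ (u ∧w y))
  w w' : Word (n + suc n)
  w = (x ⊕ y) ++ (m ∷ x)
  w' = (X ⊕ act π y) ++ (m ∷ X)
  X-at : ∀ i → lookup X (π ⟨$⟩ʳ i) ≡ lookup x i xor (lookup u i ∧ lookup y i)
  X-at i = trans (lookup-act π (x ⊕ (u ∧w y)) i)
    (trans (lookup-⊕ x (u ∧w y) i) (cong (lookup x i xor_) (lookup-zipWith _∧_ i u y)))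
  agree : ∀ {j} → Position n j → lookup w' (ρ ⟨$⟩ʳ j) ≡ lookup w j
  agree centre = begin
    lookup w' (ρ ⟨$⟩ʳ mid n)  ≡⟨ cong (lookup w') (trans (ρ-form (mid n)) (sigma-tau-mid π u)) ⟩
    lookup w' (mid n)         ≡⟨ lookup-mid (X ⊕ act π y) X m ⟩
    m                         ≡⟨ lookup-mid (x ⊕ y) x m ⟨
    lookup w (mid n)          ∎
  agree (at i b) = begin
    lookup w' (ρ ⟨$⟩ʳ pos i b)
      ≡⟨ cong (lookup w') (trans (ρ-form (pos i b)) (sigma-tau-pos π u i b)) ⟩
    lookup w' (pos (π ⟨$⟩ʳ i) (b xor uᵢ))
      ≡⟨ lookup-pos (X ⊕ act π y) X m (π ⟨$⟩ʳ i) (b xor uᵢ) ⟩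
    (if b xor uᵢ then lookup X (π ⟨$⟩ʳ i) else lookup (X ⊕ act π y) (π ⟨$⟩ʳ i))
      ≡⟨ cong₂ (if b xor uᵢ then_else_) (X-at i)
           (trans (lookup-⊕ X (act π y) _) (cong₂ _xor_ (X-at i) (lookup-act π y i))) ⟩
    (if b xor uᵢ then xᵢ xor (uᵢ ∧ yᵢ) else (xᵢ xor (uᵢ ∧ yᵢ)) xor yᵢ)
      ≡⟨ column-swap b uᵢ xᵢ yᵢ ⟩
    (if b then xᵢ else xᵢ xor yᵢ)
      ≡⟨ cong (if b then xᵢ else_) (lookup-⊕ x y i) ⟨
    (if b then lookup x i else lookup (x ⊕ y) i)
      ≡⟨ lookup-pos (x ⊕ y) x m i b ⟨
    lookup w (pos i b)
      ∎
    where
    uᵢ xᵢ yᵢ : Bool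
    uᵢ = lookup u i
    xᵢ = lookup x i
    yᵢ = lookup y i

module Translation {n} (C : Code n) (lam : Word n → Bool) (y' : Word n)
                   (π : Permutation′ n) (u : Word n) (ρ : Permutation′ (n + suc n))
                   (ρ-form : ∀ j → ρ ⟨$⟩ʳ j ≡ sigma π (tau u j)) where

  z : Word (n + suc n)
  z = vasWord lam (zeroW n) y'

  V : Code (n + suc n)
  V = Vasilev C lam

  LinearityCondition : Word n → Set
  LinearityCondition y = (lam y' xor lam y) xor lam (y' ⊕ act π y) ≡ u · y

  -- the common outer block of z + ρ(x + y, |x| + λ(y), x)
  carried : Word n → Word n → Word n
  carried x y = act π (x ⊕ (u ∧w y))

  parity-carried : ∀ x y → parity (carried x y) ≡ parity x xor (u · y)
  parity-carried x y = trans (parity-act π (x ⊕ (u ∧w y))) (parity-⊕ x (u ∧w y))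

  translate : ∀ x y → z ⊕ act ρ (vasWord lam x y)
    ≡ (carried x y ⊕ (y' ⊕ act π y)) ++ ((lam y' xor (parity x xor lam y)) ∷ carried x y)
  translate x y = begin
    z ⊕ act ρ (vasWord lam x y)
      ≡⟨ cong (z ⊕_) (duplicator-action ρ π u ρ-form x y _) ⟩
    z ⊕ ((X ⊕ act π y) ++ (m ∷ X))
      ≡⟨ ++-⊕ (zeroW n ⊕ y') (X ⊕ act π y) _ (m ∷ X) ⟩
    ((zeroW n ⊕ y') ⊕ (X ⊕ act π y)) ++ (((parity (zeroW n) xor lam y') xor m) ∷ (zeroW n ⊕ X))
      ≡⟨ cong₂ _++_ first-block (cong₂ _∷_ (cong (λ p → (p xor lam y') xor m) (parity-zeroW n))
                                           (⊕-identityˡ X)) ⟩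
    (X ⊕ (y' ⊕ act π y)) ++ ((lam y' xor m) ∷ X)
      ∎
    where
    open ≡-Reasoning
    X : Word n
    X = carried x y
    m : Bool
    m = parity x xor lam y
    first-block : (zeroW n ⊕ y') ⊕ (X ⊕ act π y) ≡ X ⊕ (y' ⊕ act π y)
    first-block = begin
      (zeroW n ⊕ y') ⊕ (X ⊕ act π y)  ≡⟨ cong (_⊕ (X ⊕ act π y)) (⊕-identityˡ y') ⟩
      y' ⊕ (X ⊕ act π y)              ≡⟨ ⊕-assoc y' X (act π y) ⟨
      (y' ⊕ X) ⊕ act π y              ≡⟨ cong (_⊕ act π y) (⊕-comm y' X) ⟩
      (X ⊕ y') ⊕ act π y              ≡⟨ ⊕-assoc X y' (act π y) ⟩
      X ⊕ (y' ⊕ act π y)              ∎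

  membership : ∀ x y → V (z ⊕ act ρ (vasWord lam x y)) ⇔ (C (y' ⊕ act π y) × LinearityCondition y)
  membership x y = mk⇔ to from
    where
    X y₁ : Word n
    X = carried x y
    y₁ = y' ⊕ act π y
    outer : (X ⊕ y₁) ⊕ X ≡ y₁
    outer = ⊕-cancelʳ X y₁
    middle : (lam y' xor (parity x xor lam y) ≡ parity X xor lam ((X ⊕ y₁) ⊕ X))
           ⇔ LinearityCondition y
    middle rewrite outer | parity-carried x y =
      middle-condition (lam y') (lam y) (lam y₁) (u · y) (parity x)
    blocks : V ((X ⊕ y₁) ++ ((lam y' xor (parity x xor lam y)) ∷ X))
           ⇔ (C ((X ⊕ y₁) ⊕ X) × lam y' xor (parity x xor lam y) ≡ parity X xor lam ((X ⊕ y₁) ⊕ X))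
    blocks = vasilev-blocks {C = C} {lam} (X ⊕ y₁) X (lam y' xor (parity x xor lam y))
    to : V (z ⊕ act ρ (vasWord lam x y)) → C y₁ × LinearityCondition y
    to v with Equivalence.to blocks (subst V (translate x y) v)
    ... | C-fold , em = subst C outer C-fold , Equivalence.to middle em
    from : C y₁ × LinearityCondition y → V (z ⊕ act ρ (vasWord lam x y))
    from (Cy₁ , cond) = subst V (sym (translate x y))
      (Equivalence.from blocks (subst C (sym outer) Cy₁ , Equivalence.from middle cond))

  preimage : ∀ {x₀ w} x y → vasWord lam x₀ w ≡ z ⊕ act ρ (vasWord lam x y) → w ≡ y' ⊕ act π y
  preimage {x₀} {w} x y e with blocks-injective (trans e (translate x y))
  ... | e-first , _ , refl = ⊕-injectiveʳ (carried x y) w (y' ⊕ act π y) e-first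

  rotation-to : InRot V z ρ → InRot C y' π × (∀ y → C y → LinearityCondition y)
  rotation-to (images , preimages) =
    ((λ y Cy → proj₁ (translate-codeword y Cy)) , codeword-preimage) ,
    (λ y Cy → proj₂ (translate-codeword y Cy))
    where
    translate-codeword : ∀ y → C y → C (y' ⊕ act π y) × LinearityCondition y
    translate-codeword y Cy =
      Equivalence.to (membership (zeroW n) y) (images _ (zeroW n , y , Cy , refl))
    codeword-preimage : ∀ w → C w → ∃ λ y → C y × w ≡ y' ⊕ act π y
    codeword-preimage w Cw with preimages _ (zeroW n , w , Cw , refl)
    ... | _ , (x , y , Cy , refl) , e = y , Cy , preimage x y e

  rotation-from : InRot C y' π → (∀ y → C y → LinearityCondition y) → InRot V z ρ
  rotation-from (images , preimages) condition = closed , surjective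
    where
    closed : ∀ v → V v → V (z ⊕ act ρ v)
    closed _ (x , y , Cy , refl) = Equivalence.from (membership x y) (images y Cy , condition y Cy)
    -- (x + w, m, x) with w = y' + π(y) is the translate of the Vasil'ev
    -- word with components x₀ = π⁻¹(x) + u ∧ y and y
    surjective : ∀ w → V w → ∃ λ v → V v × w ≡ z ⊕ act ρ v
    surjective _ (x , w , Cw , refl) with preimages w Cw
    ... | y , Cy , refl = vasWord lam x₀ y , v-in-V , sym (trans translated same-middle)
      where
      x₀ : Word n
      x₀ = act (flip π) x ⊕ (u ∧w y)
      v-in-V : V (vasWord lam x₀ y)
      v-in-V = x₀ , y , Cy , refl
      carried-x₀ : carried x₀ y ≡ x
      carried-x₀ = begin
        act π ((act (flip π) x ⊕ (u ∧w y)) ⊕ (u ∧w y))  ≡⟨ cong (act π) (⊕-assoc (act (flip π) x) (u ∧w y) (u ∧w y)) ⟩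
        act π (act (flip π) x ⊕ ((u ∧w y) ⊕ (u ∧w y)))  ≡⟨ cong (λ c → act π (act (flip π) x ⊕ c)) (⊕-self (u ∧w y)) ⟩
        act π (act (flip π) x ⊕ zeroW n)                ≡⟨ cong (act π) (⊕-identityʳ (act (flip π) x)) ⟩
        act π (act (flip π) x)                          ≡⟨ act-flip π x ⟩
        x                                               ∎
        where open ≡-Reasoning
      m₀ : Bool
      m₀ = lam y' xor (parity x₀ xor lam y)
      translated : z ⊕ act ρ (vasWord lam x₀ y) ≡ (x ⊕ (y' ⊕ act π y)) ++ (m₀ ∷ x)
      translated = trans (translate x₀ y)
        (cong (λ c → (c ⊕ (y' ⊕ act π y)) ++ (m₀ ∷ c)) carried-x₀)
      same-middle : (x ⊕ (y' ⊕ act π y)) ++ (m₀ ∷ x) ≡ vasWord lam x (y' ⊕ act π y)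
      same-middle = cong (λ m → (x ⊕ (y' ⊕ act π y)) ++ (m ∷ x))
        (vasilev-middle-unique (subst V translated (closed _ v-in-V)) (x , _ , Cw , refl))

-- Permutations mapping columns to columns.

MapsColumns : ∀ {n} → Permutation′ (n + suc n) → Set
MapsColumns {n} θ = ∀ (i : Fin n) → ∃ λ a → ∃ λ β → ∀ b → θ ⟨$⟩ʳ pos i b ≡ pos a (b xor β)

column-of : ∀ {n} (j : Fin (n + suc n)) → j ≢ mid n → ∃ λ a → ∃ λ β → j ≡ pos a β
column-of j = from-position (position j)
  where
  from-position : ∀ {j} → Position _ j → j ≢ mid _ → ∃ λ a → ∃ λ β → j ≡ pos a β
  from-position centre   j≢mid = ⊥-elim (j≢mid refl)
  from-position (at a β) _     = a , β , refl

off-middle : ∀ {n} (θ : Permutation′ (n + suc n)) → θ ⟨$⟩ʳ mid n ≡ mid n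
  → ∀ i b → θ ⟨$⟩ʳ pos i b ≢ mid n
off-middle θ θ-mid i b e = pos≢mid i b (⟨$⟩ʳ-injective θ (trans e (sym θ-mid)))

-- A permutation fixing the middle coordinate and mapping columns to columns
-- is σ_π ∘ τ_u: π records where the columns go and u which are swapped.
-- The inverse of π is read off from θ⁻¹ in the same way.
column-permutation : ∀ {n} (θ : Permutation′ (n + suc n)) → θ ⟨$⟩ʳ mid n ≡ mid n → MapsColumns θ
  → ∃ λ (π : Permutation′ n) → ∃ λ (u : Word n) → ∀ j → θ ⟨$⟩ʳ j ≡ sigma π (tau u j)
column-permutation {n} θ θ-mid columns = π , u , θ-form
  where
  f : Fin n → Fin n
  f i = proj₁ (columns i)
  swapped : Fin n → Bool
  swapped i = proj₁ (proj₂ (columns i))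
  θ-pos : ∀ i b → θ ⟨$⟩ʳ pos i b ≡ pos (f i) (b xor swapped i)
  θ-pos i = proj₂ (proj₂ (columns i))

  θ⁻¹-mid : θ ⟨$⟩ˡ mid n ≡ mid n
  θ⁻¹-mid = trans (cong (θ ⟨$⟩ˡ_) (sym θ-mid)) (inverseˡ θ)
  preimage : ∀ a → ∃ λ c → ∃ λ γ → θ ⟨$⟩ˡ pos a false ≡ pos c γ
  preimage a = column-of (θ ⟨$⟩ˡ pos a false) (off-middle (flip θ) θ⁻¹-mid a false)
  g : Fin n → Fin n
  g a = proj₁ (preimage a)

  f∘g : ∀ a → f (g a) ≡ a
  f∘g a with preimage a
  ... | c , γ , e = proj₁ (pos-injective {b = γ xor swapped c} {b' = false} (begin
    pos (f c) (γ xor swapped c)  ≡⟨ θ-pos c γ ⟨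
    θ ⟨$⟩ʳ pos c γ               ≡⟨ cong (θ ⟨$⟩ʳ_) e ⟨
    θ ⟨$⟩ʳ (θ ⟨$⟩ˡ pos a false)  ≡⟨ inverseʳ θ ⟩
    pos a false                  ∎))
    where open ≡-Reasoning

  g∘f : ∀ i → g (f i) ≡ i
  g∘f i with preimage (f i)
  ... | c , γ , e = proj₁ (pos-injective {b = γ} {b' = swapped i} (begin
    pos c γ                                         ≡⟨ e ⟨
    θ ⟨$⟩ˡ pos (f i) false                          ≡⟨ cong (λ β → θ ⟨$⟩ˡ pos (f i) β) (xor-same (swapped i)) ⟨
    θ ⟨$⟩ˡ pos (f i) (swapped i xor swapped i)      ≡⟨ cong (θ ⟨$⟩ˡ_) (θ-pos i (swapped i)) ⟨
    θ ⟨$⟩ˡ (θ ⟨$⟩ʳ pos i (swapped i))               ≡⟨ inverseˡ θ ⟩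
    pos i (swapped i)                               ∎))
    where open ≡-Reasoning

  π : Permutation′ n
  π = permutation f g f∘g g∘f
  u : Word n
  u = tabulate swapped

  θ-form : ∀ j → θ ⟨$⟩ʳ j ≡ sigma π (tau u j)
  θ-form j = agree (position j)
    where
    agree : ∀ {j} → Position n j → θ ⟨$⟩ʳ j ≡ sigma π (tau u j)
    agree centre   = trans θ-mid (sym (sigma-tau-mid π u))
    agree (at i b) = trans (θ-pos i b)
      (sym (trans (sigma-tau-pos π u i b) (cong (λ β → pos (f i) (b xor β)) (lookup∘tabulate swapped i))))

column-word : ∀ {n} → Fin n → Word (n + suc n)
column-word {n} i = unit (pos i false) ⊕ (unit (mid n) ⊕ unit (pos i true))

column-word-blocks : ∀ {n} (i : Fin n) → column-word i ≡ unit i ++ (true ∷ unit i)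
column-word-blocks {n} i = begin
  unit (pos i false) ⊕ (unit (mid n) ⊕ unit (pos i true))
    ≡⟨ cong₂ _⊕_ (unit-↑ˡ (suc n) i) (cong₂ _⊕_ (unit-↑ʳ n zero) (unit-↑ʳ n (suc i))) ⟩
  (unit i ++ zeroW (suc n)) ⊕ ((zeroW n ++ unit zero) ⊕ (zeroW n ++ unit (suc i)))
    ≡⟨ cong ((unit i ++ zeroW (suc n)) ⊕_) (++-⊕ (zeroW n) (zeroW n) (unit zero) (unit (suc i))) ⟩
  (unit i ++ zeroW (suc n)) ⊕ ((zeroW n ⊕ zeroW n) ++ (unit zero ⊕ unit (suc i)))
    ≡⟨ ++-⊕ (unit i) (zeroW n ⊕ zeroW n) (zeroW (suc n)) (unit zero ⊕ unit (suc i)) ⟩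
  (unit i ⊕ (zeroW n ⊕ zeroW n)) ++ (true ∷ (zeroW n ⊕ (zeroW n ⊕ unit i)))
    ≡⟨ cong₂ (λ A B → A ++ (true ∷ B))
         (trans (cong (unit i ⊕_) (⊕-self (zeroW n))) (⊕-identityʳ (unit i)))
         (trans (⊕-identityˡ (zeroW n ⊕ unit i)) (⊕-identityˡ (unit i))) ⟩
  unit i ++ (true ∷ unit i)
    ∎
  where open ≡-Reasoning

column-word-vasilev : ∀ {n} {C : Code n} {lam : Word n → Bool} → C (zeroW n) → lam (zeroW n) ≡ false
  → ∀ i → Vasilev C lam (column-word i)
column-word-vasilev {n} C0 lam0 i = unit i , zeroW n , C0 , trans (column-word-blocks i)
  (sym (cong₂ (λ A m → A ++ (m ∷ unit i)) (⊕-identityʳ (unit i)) (cong₂ _xor_ (parity-unit i) lam0)))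

act-column-word : ∀ {n} (θ : Permutation′ (n + suc n)) → θ ⟨$⟩ʳ mid n ≡ mid n → ∀ i
  → act θ (column-word i) ≡ unit (θ ⟨$⟩ʳ pos i false) ⊕ (unit (mid n) ⊕ unit (θ ⟨$⟩ʳ pos i true))
act-column-word {n} θ θ-mid i = begin
  act θ (unit (pos i false) ⊕ (unit (mid n) ⊕ unit (pos i true)))
    ≡⟨ act-⊕ θ (unit (pos i false)) _ ⟩
  act θ (unit (pos i false)) ⊕ act θ (unit (mid n) ⊕ unit (pos i true))
    ≡⟨ cong (act θ (unit (pos i false)) ⊕_) (act-⊕ θ (unit (mid n)) (unit (pos i true))) ⟩
  act θ (unit (pos i false)) ⊕ (act θ (unit (mid n)) ⊕ act θ (unit (pos i true)))
    ≡⟨ cong₂ _⊕_ (act-unit θ (pos i false))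
         (cong₂ _⊕_ (trans (act-unit θ (mid n)) (cong unit θ-mid)) (act-unit θ (pos i true))) ⟩
  unit (θ ⟨$⟩ʳ pos i false) ⊕ (unit (mid n) ⊕ unit (θ ⟨$⟩ʳ pos i true))
    ∎
  where open ≡-Reasoning

fold-column-image : ∀ {n} (a a' : Fin n) β β'
  → fold (unit (pos a β) ⊕ (unit (mid n) ⊕ unit (pos a' β'))) ≡ unit a ⊕ unit a'
fold-column-image {n} a a' β β' = begin
  fold (unit (pos a β) ⊕ (unit (mid n) ⊕ unit (pos a' β')))
    ≡⟨ fold-⊕ (unit (pos a β)) _ ⟩
  fold (unit (pos a β)) ⊕ fold (unit (mid n) ⊕ unit (pos a' β'))
    ≡⟨ cong (fold (unit (pos a β)) ⊕_) (fold-⊕ (unit (mid n)) (unit (pos a' β'))) ⟩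
  fold (unit (pos a β)) ⊕ (fold (unit (mid n)) ⊕ fold (unit (pos a' β')))
    ≡⟨ cong₂ _⊕_ (fold-unit-pos a β) (cong₂ _⊕_ (fold-unit-mid n) (fold-unit-pos a' β')) ⟩
  unit a ⊕ (zeroW n ⊕ unit a')
    ≡⟨ cong (unit a ⊕_) (⊕-identityˡ (unit a')) ⟩
  unit a ⊕ unit a'
    ∎
  where open ≡-Reasoning

-- Let ρ ∈ Rot_z(V_C^λ) fix the middle coordinate.  The column word of i lies in
-- V_C^λ, so z + ρ(column word) does too and its fold y' + e_a + e_{a'} lies in C,
-- where a, a' are the columns of the images of the two ends of column i.  As
-- y' ∈ C and C is perfect, a = a': the column is mapped onto column a.
rotation-maps-columns : ∀ {n} {C : Code n} {lam : Word n → Bool} {y' : Word n}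
  → Perfect C → C (zeroW n) → lam (zeroW n) ≡ false → C y'
  → (ρ : Permutation′ (n + suc n)) → InRot (Vasilev C lam) (vasWord lam (zeroW n) y') ρ
  → ρ ⟨$⟩ʳ mid n ≡ mid n → MapsColumns ρ
rotation-maps-columns {n} {C} {lam} {y'} perfect C0 lam0 Cy' ρ rotation ρ-mid i =
  same-column (column-of (ρ ⟨$⟩ʳ pos i false) (off-middle ρ ρ-mid i false))
              (column-of (ρ ⟨$⟩ʳ pos i true)  (off-middle ρ ρ-mid i true))
  where
  z : Word (n + suc n)
  z = vasWord lam (zeroW n) y'
  same-column : (∃ λ a → ∃ λ β → ρ ⟨$⟩ʳ pos i false ≡ pos a β)
    → (∃ λ a' → ∃ λ β' → ρ ⟨$⟩ʳ pos i true ≡ pos a' β')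
    → ∃ λ a → ∃ λ β → ∀ b → ρ ⟨$⟩ʳ pos i b ≡ pos a (b xor β)
  same-column (a , β , e-false) (a' , β' , e-true) = a , β , images
    where
    folded : fold (z ⊕ act ρ (column-word i)) ≡ y' ⊕ (unit a ⊕ unit a')
    folded = begin
      fold (z ⊕ act ρ (column-word i))
        ≡⟨ fold-⊕ z (act ρ (column-word i)) ⟩
      fold z ⊕ fold (act ρ (column-word i))
        ≡⟨ cong₂ _⊕_ (fold-vasWord lam (zeroW n) y') (cong fold (act-column-word ρ ρ-mid i)) ⟩
      y' ⊕ fold (unit (ρ ⟨$⟩ʳ pos i false) ⊕ (unit (mid n) ⊕ unit (ρ ⟨$⟩ʳ pos i true)))
        ≡⟨ cong₂ (λ j k → y' ⊕ fold (unit j ⊕ (unit (mid n) ⊕ unit k))) e-false e-true ⟩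
      y' ⊕ fold (unit (pos a β) ⊕ (unit (mid n) ⊕ unit (pos a' β')))
        ≡⟨ cong (y' ⊕_) (fold-column-image a a' β β') ⟩
      y' ⊕ (unit a ⊕ unit a')
        ∎
      where open ≡-Reasoning
    a≡a' : a ≡ a'
    a≡a' = perfect-no-distance-two perfect Cy'
      (subst C folded (vasilev-fold (proj₁ rotation _ (column-word-vasilev C0 lam0 i))))
    β'≢β : β' ≢ β
    β'≢β refl = false≢true (proj₂ (pos-injective {i = i} {i} {false} {true}
      (⟨$⟩ʳ-injective ρ (trans e-false (trans (cong (λ c → pos c β) a≡a') (sym e-true))))))
      where
      false≢true : false ≢ true
      false≢true ()
    images : ∀ b → ρ ⟨$⟩ʳ pos i b ≡ pos a (b xor β)
    images false = e-false
    images true  = trans e-true (cong₂ pos (sym a≡a') (¬-not β'≢β))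

mainTheorem2 : (k n : ℕ) → n ≡ 2 ^ k ∸ 1
    → (C : Code n) → Perfect C → C (zeroW n)
    → (lam : Word n → Bool) → lam (zeroW n) ≡ false
    → (y' : Word n) → C y'
    → (ρ : Permutation′ (n + suc n))
    → (InRot (Vasilev C lam) (vasWord lam (zeroW n) y') ρ × ρ ⟨$⟩ʳ mid n ≡ mid n)
      ⇔ (∃ λ (π : Permutation′ n) → ∃ λ (u : Word n) →
           InRot C y' π
           × (∀ j → ρ ⟨$⟩ʳ j ≡ sigma π (tau u j))
           × (∀ y → C y → (lam y' xor lam y) xor lam (y' ⊕ act π y) ≡ u · y))
mainTheorem2 k n _ C perfect C0 lam lam0 y' Cy' ρ = mk⇔
  (λ (rotation , ρ-mid) →
    let (π , u , ρ-form) = column-permutation ρ ρ-mid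
                             (rotation-maps-columns perfect C0 lam0 Cy' ρ rotation ρ-mid)
        (π-rotation , linearity) = Translation.rotation-to C lam y' π u ρ ρ-form rotation
    in π , u , π-rotation , ρ-form , linearity)
  (λ (π , u , π-rotation , ρ-form , linearity) →
    Translation.rotation-from C lam y' π u ρ ρ-form π-rotation linearity ,
    trans (ρ-form (mid n)) (sigma-tau-mid π u))
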